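{- Let $n$ be a positive integer and, for integers $1\le a<b\le 2n$, let $G_1([a,b],[-1,1];2n)$ denote the number of complete Gessel words of length $2n$ whose letter at position $a$ is $\bar{1}$, whose letter at position $b$ is $1$, and whose other letters all lie in $\{2,\bar{2}\}$. Then for all integers $i,j$ with $1\le i<j\le n-1$, $$G_1([2i,2j],[-1,1];2n)=G_1([2i,2j+1],[-1,1];2n)=G_1([2i+1,2j],[-1,1];2n)=G_1([2i+1,2j+1],[-1,1];2n).$$
   Context: Words are finite sequences over the alphabet $\{1,2,\bar{1},\bar{2}\}$. For a word $x$ and letter $\alpha$, $N_\alpha(x)$ is the number of occurrences of $\alpha$ in $x$. A word $w$ is a Gessel word if every prefix $x$ of $w$ satisfies $N_2(x)-N_{\bar{2}}(x)\ge 0$ and $N_2(x)+N_1(x)-N_{\bar{2}}(x)-N_{\bar{1}}(x)\ge 0$; it is complete if moreover $N_1(w)=N_{\bar{1}}(w)$ and $N_2(w)=N_{\bar{2}}(w)$. -}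

module Defs where

open import Data.Nat using (ℕ; zero; suc; _≡ᵇ_)
import Data.Integer as ℤ
open import Data.Bool using (Bool; true; false; _∧_; if_then_else_)
open import Data.List using (List; []; _∷_; length; filter; concatMap; inits)
open import Data.List.Relation.Unary.All using (All; all?)
open import Data.Product using (_×_; _,_)
open import Data.Unit using (⊤)
open import Data.Empty using (⊥)
open import Relation.Nullary.Decidable using (Dec; yes; no; _×-dec_)
open import Relation.Binary.PropositionalEquality using (_≡_; refl)
import Data.Nat as ℕ

data Letter : Set where
  one two one̅ two̅ : Letter

_≟L_ : (α β : Letter) → Dec (α ≡ β)
one  ≟L one  = yes refl
two  ≟L two  = yes refl
one̅ ≟L one̅ = yes refl
two̅ ≟L two̅ = yes refl
one  ≟L two  = no λ ()
one  ≟L one̅ = no λ ()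
one  ≟L two̅ = no λ ()
two  ≟L one  = no λ ()
two  ≟L one̅ = no λ ()
two  ≟L two̅ = no λ ()
one̅ ≟L one  = no λ ()
one̅ ≟L two  = no λ ()
one̅ ≟L two̅ = no λ ()
two̅ ≟L one  = no λ ()
two̅ ≟L two  = no λ ()
two̅ ≟L one̅ = no λ ()

Word : Set
Word = List Letter

N : Letter → Word → ℕ
N α []      = 0
N α (β ∷ x) with α ≟L β
... | yes _ = suc (N α x)
... | no  _ = N α x

PrefixOK : Word → Set
PrefixOK x =
  (ℤ.+ 0 ℤ.≤ (ℤ.+ N two x ℤ.- ℤ.+ N two̅ x)) ×
  (ℤ.+ 0 ℤ.≤ ((ℤ.+ N two x ℤ.+ ℤ.+ N one x) ℤ.- (ℤ.+ N two̅ x ℤ.+ ℤ.+ N one̅ x)))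

IsGessel : Word → Set
IsGessel w = All PrefixOK (inits w)

IsCompleteGessel : Word → Set
IsCompleteGessel w = IsGessel w × (N one w ≡ N one̅ w) × (N two w ≡ N two̅ w)

IsTwoLetter : Letter → Set
IsTwoLetter two  = ⊤
IsTwoLetter two̅ = ⊤
IsTwoLetter one  = ⊥
IsTwoLetter one̅ = ⊥

-- ShapeFrom a b k x : reading x with its first letter at (1-indexed) position k,
-- the letter at position a is 1̄, at position b is 1, every other letter is in {2, 2̄}
ShapeFrom : ℕ → ℕ → ℕ → Word → Set
ShapeFrom a b k []      = ⊤
ShapeFrom a b k (α ∷ x) =
  (if k ≡ᵇ a then α ≡ one̅ else (if k ≡ᵇ b then α ≡ one else IsTwoLetter α))
  × ShapeFrom a b (suc k) x

Shape : ℕ → ℕ → Word → Set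
Shape a b w = ShapeFrom a b 1 w

-- all words of length m over the alphabet (each exactly once)
allWords : ℕ → List Word
allWords zero    = [] ∷ []
allWords (suc m) = concatMap (λ w → (one ∷ w) ∷ (two ∷ w) ∷ (one̅ ∷ w) ∷ (two̅ ∷ w) ∷ []) (allWords m)

PrefixOK? : (x : Word) → Dec (PrefixOK x)
PrefixOK? x = (ℤ.+ 0 ℤ.≤? _) ×-dec (ℤ.+ 0 ℤ.≤? _)

IsGessel? : (w : Word) → Dec (IsGessel w)
IsGessel? w = all? PrefixOK? (inits w)

IsCompleteGessel? : (w : Word) → Dec (IsCompleteGessel w)
IsCompleteGessel? w = IsGessel? w ×-dec (N one w ℕ.≟ N one̅ w ×-dec N two w ℕ.≟ N two̅ w)

IsTwoLetter? : (α : Letter) → Dec (IsTwoLetter α)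
IsTwoLetter? one  = no λ ()
IsTwoLetter? two  = yes _
IsTwoLetter? one̅ = no λ ()
IsTwoLetter? two̅ = yes _

ShapeFrom? : (a b k : ℕ) (x : Word) → Dec (ShapeFrom a b k x)
ShapeFrom? a b k []      = yes _
ShapeFrom? a b k (α ∷ x) = letter? ×-dec ShapeFrom? a b (suc k) x
  where
  letter? : Dec (if k ≡ᵇ a then α ≡ one̅ else (if k ≡ᵇ b then α ≡ one else IsTwoLetter α))
  letter? with k ≡ᵇ a | k ≡ᵇ b
  ... | true  | _     = α ≟L one̅
  ... | false | true  = α ≟L one
  ... | false | false = IsTwoLetter? α

G₁ : ℕ → ℕ → ℕ → ℕ
G₁ a b m = length (filter (λ w → IsCompleteGessel? w ×-dec ShapeFrom? a b 1 w) (allWords m))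

module Submission where

-- Read a word as a lattice walk from (0 , 0) in the coordinates
-- u = N₂ − N₂̄ and v = N₂ + N₁ − N₂̄ − N₁̄: the letter 2 steps by (+1,+1), 2̄ by
-- (−1,−1), 1 by (0,+1) and 1̄ by (0,−1).  A word is Gessel iff this walk never
-- leaves the quadrant u, v ≥ 0.  Exchanging the letters at positions P, P + 1
-- changes a single intermediate point of the walk, and from a point with
-- u, v ≥ 1 any two steps commute inside the quadrant; so the exchange preserves
-- (complete) Gesselness as soon as the walk is strictly inside the quadrant
-- just before position P.  For the words counted by G₁ a parity invariant
-- guarantees this when P is even: before the 1̄ the walk is on the diagonal at
-- odd height, afterwards one below the diagonal at even height.  As the
-- exchange is an involution on the words of a fixed length and turns the shape
-- (P , b) into (P + 1 , b) and (a , P + 1) into (a , P), the counts agree.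

open import Defs
open import Data.Bool using (true; false; T; if_then_else_)
open import Data.Bool.Properties using (T-≡; ¬-not)
open import Data.Integer as ℤ using (ℤ; +_; +≤+)
import Data.Integer.Properties as ℤ
open import Data.Integer.Tactic.RingSolver using (solve-∀)
open import Data.List using (List; []; _∷_; _++_; map; concatMap; filter; take; inits; length)
open import Data.List.Properties using (map-++; map-cong; map-cong-local)
open import Data.List.Relation.Unary.All as All using (All; []; _∷_)
open import Data.List.Relation.Unary.All.Properties using (map⁺; map⁻; concat⁺)
open import Data.Maybe using (Maybe; just; nothing; _>>=_; is-just)
open import Data.Nat using (ℕ; zero; suc; _+_; _*_; _≤_; _<_; _∸_; _≡ᵇ_; z≤n; s≤s; parity)
open import Data.Nat.ListAction using (sum)
open import Data.Nat.ListAction.Properties using (sum-++)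
open import Data.Nat.Properties
  using ( +-suc; +-identityʳ; +-comm; +-commutativeSemigroup; *-suc; *-monoʳ-≤
        ; ≡ᵇ⇒≡; ≡⇒≡ᵇ; <⇒≢; >⇒≢; ≤-refl; ≤-trans; <-trans; <⇒≤; <-irrefl; ≤∧≢⇒<
        ; n≤1+n; n<1+n; m≤n⇒m≤1+n; m<m+n; m≤n+m )
open import Algebra.Properties.CommutativeSemigroup +-commutativeSemigroup using (x∙yz≈y∙xz; interchange)
open import Data.Parity using (0ℙ; 1ℙ; _⁻¹)
open import Data.Parity.Properties using (⁻¹-involutive; suc-homo-⁻¹; *-homo-*)
open import Data.Product using (_×_; _,_)
open import Data.Product.Function.NonDependent.Propositional using (_×-⇔_)
open import Data.Unit using (tt)
open import Function using (id; _∘_)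
open import Function.Bundles using (_⇔_; mk⇔; Equivalence)
open import Relation.Binary.PropositionalEquality
open import Relation.Nullary using (¬_; Dec; does; contradiction)
open import Relation.Nullary.Decidable using (does-⇔)

Point : Set
Point = ℕ × ℕ

move : Letter → Point → Maybe Point
move one  (u , v)         = just (u , suc v)
move two  (u , v)         = just (suc u , suc v)
move one̅ (u , suc v)     = just (u , v)
move two̅ (suc u , suc v) = just (u , v)
move _    _               = nothing

reach : Point → Word → Maybe Point
reach p []      = just p
reach p (x ∷ w) = move x p >>= λ q → reach q w

Stays : Point → Word → Set
Stays p w = T (is-just (reach p w))

-- The two quantities constrained by a Gessel prefix: PrefixOK p is literally
-- 0 ≤ heightᵤ p and 0 ≤ heightᵥ p.
heightᵤ : Word → ℤ
heightᵤ x = + N two x ℤ.- + N two̅ x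

heightᵥ : Word → ℤ
heightᵥ x = (+ N two x ℤ.+ + N one x) ℤ.- (+ N two̅ x ℤ.+ + N one̅ x)

stepᵤ : Letter → ℤ
stepᵤ two  = + 1
stepᵤ two̅ = ℤ.- + 1
stepᵤ _    = + 0

stepᵥ : Letter → ℤ
stepᵥ one̅ = ℤ.- + 1
stepᵥ two̅ = ℤ.- + 1
stepᵥ _    = + 1

heightᵤ-∷ : ∀ x p → heightᵤ (x ∷ p) ≡ stepᵤ x ℤ.+ heightᵤ p
heightᵤ-∷ one  p = sym (ℤ.+-identityˡ (heightᵤ p))
heightᵤ-∷ one̅ p = sym (ℤ.+-identityˡ (heightᵤ p))
heightᵤ-∷ two  p = ℤ.+-assoc (+ 1) (+ N two p) (ℤ.- + N two̅ p)
heightᵤ-∷ two̅ p = down (+ N two p) (+ N two̅ p)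
  where
  down : ∀ A B → A ℤ.- (+ 1 ℤ.+ B) ≡ ℤ.- + 1 ℤ.+ (A ℤ.- B)
  down = solve-∀

heightᵥ-∷ : ∀ x p → heightᵥ (x ∷ p) ≡ stepᵥ x ℤ.+ heightᵥ p
heightᵥ-∷ one  p = up (+ N two p) (+ N one p) (+ N two̅ p) (+ N one̅ p)
  where
  up : ∀ A C B D → (A ℤ.+ (+ 1 ℤ.+ C)) ℤ.- (B ℤ.+ D) ≡ + 1 ℤ.+ ((A ℤ.+ C) ℤ.- (B ℤ.+ D))
  up = solve-∀
heightᵥ-∷ two  p = up (+ N two p) (+ N one p) (+ N two̅ p) (+ N one̅ p)
  where
  up : ∀ A C B D → ((+ 1 ℤ.+ A) ℤ.+ C) ℤ.- (B ℤ.+ D) ≡ + 1 ℤ.+ ((A ℤ.+ C) ℤ.- (B ℤ.+ D))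
  up = solve-∀
heightᵥ-∷ one̅ p = down (+ N two p) (+ N one p) (+ N two̅ p) (+ N one̅ p)
  where
  down : ∀ A C B D → (A ℤ.+ C) ℤ.- (B ℤ.+ (+ 1 ℤ.+ D)) ≡ ℤ.- + 1 ℤ.+ ((A ℤ.+ C) ℤ.- (B ℤ.+ D))
  down = solve-∀
heightᵥ-∷ two̅ p = down (+ N two p) (+ N one p) (+ N two̅ p) (+ N one̅ p)
  where
  down : ∀ A C B D → (A ℤ.+ C) ℤ.- ((+ 1 ℤ.+ B) ℤ.+ D) ≡ ℤ.- + 1 ℤ.+ ((A ℤ.+ C) ℤ.- (B ℤ.+ D))
  down = solve-∀

move-steps : ∀ x {u v u′ v′} → move x (u , v) ≡ just (u′ , v′) →
             (+ u ℤ.+ stepᵤ x ≡ + u′) × (+ v ℤ.+ stepᵥ x ≡ + v′)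
move-steps one  {u} {v}         refl = ℤ.+-identityʳ (+ u) , ℤ.+-comm (+ v) (+ 1)
move-steps two  {u} {v}         refl = ℤ.+-comm (+ u) (+ 1) , ℤ.+-comm (+ v) (+ 1)
move-steps one̅ {u} {suc v}     refl = ℤ.+-identityʳ (+ u) , refl
move-steps two̅ {suc u} {suc v} refl = refl , refl

Fits : ℤ → ℤ → Word → Set
Fits U V p = (+ 0 ℤ.≤ U ℤ.+ heightᵤ p) × (+ 0 ℤ.≤ V ℤ.+ heightᵥ p)

fits-∷ : ∀ U V x p → Fits U V (x ∷ p) ≡ Fits (U ℤ.+ stepᵤ x) (V ℤ.+ stepᵥ x) p
fits-∷ U V x p = cong₂ _×_ (cong (+ 0 ℤ.≤_) (shift U (stepᵤ x) (heightᵤ-∷ x p)))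
                           (cong (+ 0 ℤ.≤_) (shift V (stepᵥ x) (heightᵥ-∷ x p)))
  where
  shift : ∀ S s {h h′} → h′ ≡ s ℤ.+ h → S ℤ.+ h′ ≡ (S ℤ.+ s) ℤ.+ h
  shift S s {h} refl = sym (ℤ.+-assoc S s h)

fits-move : ∀ x {u v u′ v′} → move x (u , v) ≡ just (u′ , v′) →
            ∀ p → Fits (+ u) (+ v) (x ∷ p) ≡ Fits (+ u′) (+ v′) p
fits-move x moved p with move-steps x moved
... | u-step , v-step = trans (fits-∷ (+ _) (+ _) x p) (cong₂ (λ U V → Fits U V p) u-step v-step)

fits-[] : ∀ u v → Fits (+ u) (+ v) []
fits-[] u v = +≤+ z≤n , +≤+ z≤n

move-fails : ∀ x {u v} → move x (u , v) ≡ nothing → ¬ Fits (+ u) (+ v) (x ∷ [])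
move-fails one̅ {v = zero}     _ (_ , ())
move-fails two̅ {zero}         _ (() , _)
move-fails two̅ {suc u} {zero} _ (_ , ())

All-≡ : ∀ {A : Set} {P Q : A → Set} {xs} → (∀ x → P x ≡ Q x) → All P xs → All Q xs
All-≡ P≡Q = All.map (λ {x} → subst id (P≡Q x))

prefixes⇔stays : ∀ w u v → All (Fits (+ u) (+ v)) (inits w) ⇔ Stays (u , v) w
prefixes⇔stays []      u v = mk⇔ (λ _ → tt) (λ _ → fits-[] u v ∷ [])
prefixes⇔stays (x ∷ w) u v with move x (u , v) in moved
... | nothing        = mk⇔ (λ { (_ ∷ fits ∷ _) → move-fails x moved fits }) (λ ())
... | just (u′ , v′) = mk⇔
  (λ { (_ ∷ fits) → Equivalence.to rest (All-≡ (fits-move x moved) (map⁻ fits)) })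
  (λ stays → fits-[] u v ∷ map⁺ (All-≡ (λ p → sym (fits-move x moved p)) (Equivalence.from rest stays)))
  where rest = prefixes⇔stays w u′ v′

gessel⇔stays : ∀ w → IsGessel w ⇔ Stays (0 , 0) w
gessel⇔stays w = mk⇔
  (λ g → Equivalence.to (prefixes⇔stays w 0 0) (All-≡ prefixOK≡fits g))
  (λ s → All-≡ (λ p → sym (prefixOK≡fits p)) (Equivalence.from (prefixes⇔stays w 0 0) s))
  where
  prefixOK≡fits : ∀ p → PrefixOK p ≡ Fits (+ 0) (+ 0) p
  prefixOK≡fits p = cong₂ _×_ (cong (+ 0 ℤ.≤_) (sym (ℤ.+-identityˡ (heightᵤ p))))
                              (cong (+ 0 ℤ.≤_) (sym (ℤ.+-identityˡ (heightᵥ p))))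

gessel-reach : ∀ w w′ → reach (0 , 0) w ≡ reach (0 , 0) w′ → IsGessel w ⇔ IsGessel w′
gessel-reach w w′ same = mk⇔
  (λ g → Equivalence.from (gessel⇔stays w′) (subst (T ∘ is-just) same (Equivalence.to (gessel⇔stays w) g)))
  (λ g → Equivalence.from (gessel⇔stays w) (subst (T ∘ is-just) (sym same) (Equivalence.to (gessel⇔stays w′) g)))

-- Exchange of the entries at (0-based) positions k and k + 1; the identity on shorter lists.
swapAt : ∀ {A : Set} → ℕ → List A → List A
swapAt zero    (x ∷ y ∷ r) = y ∷ x ∷ r
swapAt (suc k) (x ∷ w)     = x ∷ swapAt k w
swapAt _       w           = w

data Interior : Point → Set where
  interior : ∀ {u v} → Interior (suc u , suc v)

-- From an interior point two consecutive steps commute, as no single step can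
-- leave the quadrant (the outcome is then the same, including failure).
move-comm : ∀ x y u v (f : Point → Maybe Point) →
            (move x (suc u , suc v) >>= λ q → move y q >>= f) ≡ (move y (suc u , suc v) >>= λ q → move x q >>= f)
move-comm one  one  u v       f = refl
move-comm one  two  u v       f = refl
move-comm one  one̅ u v       f = refl
move-comm one  two̅ u v       f = refl
move-comm two  one  u v       f = refl
move-comm two  two  u v       f = refl
move-comm two  one̅ u v       f = refl
move-comm two  two̅ u v       f = refl
move-comm one̅ one  u v       f = refl
move-comm one̅ two  u v       f = refl
move-comm one̅ one̅ u v       f = refl
move-comm one̅ two̅ u zero    f = refl
move-comm one̅ two̅ u (suc v) f = refl
move-comm two̅ one  u v       f = refl
move-comm two̅ two  u v       f = refl
move-comm two̅ one̅ u zero    f = refl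
move-comm two̅ one̅ u (suc v) f = refl
move-comm two̅ two̅ u v       f = refl

reach-swapAt : ∀ k p w → (∀ {q} → reach p (take k w) ≡ just q → Interior q) →
               reach p (swapAt k w) ≡ reach p w
reach-swapAt zero    p (x ∷ y ∷ r) inside with inside refl
... | interior = move-comm y x _ _ (λ q → reach q r)
reach-swapAt zero    p []          inside = refl
reach-swapAt zero    p (x ∷ [])    inside = refl
reach-swapAt (suc k) p []          inside = refl
reach-swapAt (suc k) p (x ∷ w)     inside with move x p
... | nothing = refl
... | just q  = reach-swapAt k q w inside

N-∷ : ∀ α x w → N α (x ∷ w) ≡ N α (x ∷ []) + N α w
N-∷ one one w = refl
N-∷ one two w = refl
N-∷ one one̅ w = refl
N-∷ one two̅ w = refl
N-∷ two one w = refl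
N-∷ two two w = refl
N-∷ two one̅ w = refl
N-∷ two two̅ w = refl
N-∷ one̅ one w = refl
N-∷ one̅ two w = refl
N-∷ one̅ one̅ w = refl
N-∷ one̅ two̅ w = refl
N-∷ two̅ one w = refl
N-∷ two̅ two w = refl
N-∷ two̅ one̅ w = refl
N-∷ two̅ two̅ w = refl

N-swapAt : ∀ α k w → N α (swapAt k w) ≡ N α w
N-swapAt α zero (x ∷ y ∷ r) = begin
  N α (y ∷ x ∷ r)                        ≡⟨ N-∷ α y (x ∷ r) ⟩
  N α (y ∷ []) + N α (x ∷ r)             ≡⟨ cong (_+_ (N α (y ∷ []))) (N-∷ α x r) ⟩
  N α (y ∷ []) + (N α (x ∷ []) + N α r)  ≡⟨ x∙yz≈y∙xz (N α (y ∷ [])) (N α (x ∷ [])) (N α r) ⟩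
  N α (x ∷ []) + (N α (y ∷ []) + N α r)  ≡⟨ cong (_+_ (N α (x ∷ []))) (N-∷ α y r) ⟨
  N α (x ∷ []) + N α (y ∷ r)             ≡⟨ N-∷ α x (y ∷ r) ⟨
  N α (x ∷ y ∷ r)                        ∎
  where open ≡-Reasoning
N-swapAt α zero    []       = refl
N-swapAt α zero    (x ∷ []) = refl
N-swapAt α (suc k) []       = refl
N-swapAt α (suc k) (x ∷ w)  =
  trans (N-∷ α x (swapAt k w)) (trans (cong (_+_ (N α (x ∷ []))) (N-swapAt α k w)) (sym (N-∷ α x w)))

completeGessel-swapAt : ∀ k w → reach (0 , 0) (swapAt k w) ≡ reach (0 , 0) w →
                        IsCompleteGessel (swapAt k w) ⇔ IsCompleteGessel w
completeGessel-swapAt k w same = gessel-reach _ _ same ×-⇔ (balanced one one̅ ×-⇔ balanced two two̅)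
  where
  balanced : ∀ α β → (N α (swapAt k w) ≡ N β (swapAt k w)) ⇔ (N α w ≡ N β w)
  balanced α β = mk⇔ (λ e → trans (sym (N-swapAt α k w)) (trans e (N-swapAt β k w)))
                     (λ e → trans (N-swapAt α k w) (trans e (sym (N-swapAt β k w))))

-- The constraint of the shape (a , b) on the letter at position t; by definition
-- ShapeFrom a b t (α ∷ x) is Allowed a b t α × ShapeFrom a b (suc t) x.
Allowed : ℕ → ℕ → ℕ → Letter → Set
Allowed a b t α = if t ≡ᵇ a then α ≡ one̅ else (if t ≡ᵇ b then α ≡ one else IsTwoLetter α)

SameRole : (a b t a′ b′ t′ : ℕ) → Set
SameRole a b t a′ b′ t′ = ((t ≡ᵇ a) ≡ (t′ ≡ᵇ a′)) × ((t ≡ᵇ b) ≡ (t′ ≡ᵇ b′))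

allowed-≡ : ∀ a b t a′ b′ t′ → SameRole a b t a′ b′ t′ → Allowed a b t ≡ Allowed a′ b′ t′
allowed-≡ a b t a′ b′ t′ (same-a , same-b) =
  cong₂ (λ at bt α → if at then α ≡ one̅ else (if bt then α ≡ one else IsTwoLetter α)) same-a same-b

≡ᵇ-refl : ∀ n → (n ≡ᵇ n) ≡ true
≡ᵇ-refl n = Equivalence.to T-≡ (≡⇒≡ᵇ n n refl)

≡ᵇ-≢ : ∀ {m n} → m ≢ n → (m ≡ᵇ n) ≡ false
≡ᵇ-≢ {m} {n} m≢n = ¬-not (λ eq → m≢n (≡ᵇ⇒≡ m n (Equivalence.from T-≡ eq)))

both-false : ∀ {m n m′ n′} → m ≢ n → m′ ≢ n′ → (m ≡ᵇ n) ≡ (m′ ≡ᵇ n′)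
both-false m≢n m′≢n′ = trans (≡ᵇ-≢ m≢n) (sym (≡ᵇ-≢ m′≢n′))

≡⇒⇔ : ∀ {A B : Set} → A ≡ B → A ⇔ B
≡⇒⇔ refl = mk⇔ id id

record Transposed (a b a′ b′ P : ℕ) : Set where
  field
    outside : ∀ t → t ≢ P → t ≢ suc P → SameRole a b t a′ b′ t
    left    : SameRole a b P a′ b′ (suc P)
    right   : SameRole a b (suc P) a′ b′ P

module _ {a b a′ b′ P : ℕ} (τ : Transposed a b a′ b′ P) where
  open Transposed τ

  shape-beyond : ∀ t r → suc (suc P) ≤ t → ShapeFrom a b t r ≡ ShapeFrom a′ b′ t r
  shape-beyond t []      _     = refl
  shape-beyond t (x ∷ r) P+2≤t =
    cong₂ _×_ (cong-app (allowed-≡ a b t a′ b′ t (outside t (>⇒≢ (≤-trans (n≤1+n (suc P)) P+2≤t)) (>⇒≢ P+2≤t))) x)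
              (shape-beyond (suc t) r (m≤n⇒m≤1+n P+2≤t))

  shape-swapAt : ∀ k s w → s + k ≡ P → suc (suc k) ≤ length w →
                 ShapeFrom a b s (swapAt k w) ⇔ ShapeFrom a′ b′ s w
  shape-swapAt zero s (x ∷ y ∷ r) s+0≡P _ with trans (sym (+-identityʳ s)) s+0≡P
  ... | refl = mk⇔
    (λ { (ay , bx , rest) → subst id (cong-app right′ x) bx , subst id (cong-app left′ y) ay , subst id tail rest })
    (λ { (ax , by , rest) → subst id (sym (cong-app left′ y)) by , subst id (sym (cong-app right′ x)) ax , subst id (sym tail) rest })
    where
    left′  = allowed-≡ a b s a′ b′ (suc s) left
    right′ = allowed-≡ a b (suc s) a′ b′ s right
    tail   = shape-beyond (suc (suc s)) r ≤-refl
  shape-swapAt zero s (x ∷ []) _ (s≤s ())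
  shape-swapAt (suc k) s (x ∷ w) s+k≡P (s≤s len) =
    ≡⇒⇔ (cong-app (allowed-≡ a b s a′ b′ s (outside s (<⇒≢ s<P) (<⇒≢ (m≤n⇒m≤1+n s<P)))) x)
      ×-⇔ shape-swapAt k (suc s) w (trans (sym (+-suc s k)) s+k≡P) len
    where
    s<P : s < P
    s<P = subst (s <_) s+k≡P (m<m+n s (s≤s z≤n))

parity-suc : ∀ n → parity (suc n) ≡ parity n ⁻¹
parity-suc n = trans (sym (⁻¹-involutive (parity (suc n)))) (cong _⁻¹ (suc-homo-⁻¹ n))

data Inv (a t : ℕ) : Point → Set where
  before : ∀ {u} → t ≤ a → parity (u + t) ≡ 1ℙ → Inv a t (u , u)
  after  : ∀ {v} → a < t → parity (suc v + t) ≡ 0ℙ → Inv a t (suc v , v)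

data EarlyLetter (a t : ℕ) : Letter → Set where
  marker : t ≡ a → EarlyLetter a t one̅
  up     : t ≢ a → EarlyLetter a t two
  down   : t ≢ a → EarlyLetter a t two̅

early-letter : ∀ {a b t x} → t < b → Allowed a b t x → EarlyLetter a t x
early-letter {a} {b} {t} t<b allowed with t ≡ᵇ a in t≟a | t ≡ᵇ b in t≟b
... | true  | _     = subst (EarlyLetter a t) (sym allowed) (marker (≡ᵇ⇒≡ t a (Equivalence.from T-≡ t≟a)))
... | false | true  = contradiction (≡ᵇ⇒≡ t b (Equivalence.from T-≡ t≟b)) (<⇒≢ t<b)
... | false | false = twoLetter _ (λ t≡a → subst T t≟a (≡⇒≡ᵇ t a t≡a)) allowed
  where
  twoLetter : ∀ x → t ≢ a → IsTwoLetter x → EarlyLetter a t x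
  twoLetter two  t≢a _ = up t≢a
  twoLetter two̅ t≢a _ = down t≢a

inv-step : ∀ {a t x p p′} → EarlyLetter a t x → Inv a t p → move x p ≡ just p′ → Inv a (suc t) p′
inv-step {t = t} (marker refl) (before {suc u} _ odd) refl =
  after (n<1+n t) (trans (cong parity (+-suc (suc u) t)) (trans (parity-suc (suc u + t)) (cong _⁻¹ odd)))
inv-step (marker refl) (after a<t _) _ = contradiction a<t (<-irrefl refl)
inv-step {t = t} (up t≢a) (before {u} t≤a odd) refl =
  before (≤∧≢⇒< t≤a t≢a) (trans (cong (parity ∘ suc) (+-suc u t)) odd)
inv-step {t = t} (down t≢a) (before {suc u} t≤a odd) refl =
  before (≤∧≢⇒< t≤a t≢a) (trans (cong parity (+-suc u t)) odd)
inv-step {t = t} (up _) (after {v} a<t even) refl =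
  after (m≤n⇒m≤1+n a<t) (trans (cong (parity ∘ suc) (+-suc (suc v) t)) even)
inv-step {t = t} (down _) (after {suc v} a<t even) refl =
  after (m≤n⇒m≤1+n a<t) (trans (cong parity (+-suc (suc v) t)) even)

inv-reach : ∀ {a b} k s {t} w {p q} → k ≤ length w → ShapeFrom a b s w → s + k ≡ t → t ≤ b → Inv a s p →
            reach p (take k w) ≡ just q → Inv a t q
inv-reach zero    s w       _ _ s+0≡t _ inv refl = subst (λ t → Inv _ t _) (trans (sym (+-identityʳ s)) s+0≡t) inv
inv-reach (suc k) s (x ∷ w) {p} (s≤s k≤len) (allowed , shape) s+k≡t t≤b inv reached with move x p in moved
... | just p′ = inv-reach k (suc s) w k≤len shape s+k≡t′ t≤b (inv-step (early-letter s<b allowed) inv moved) reached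
  where
  s+k≡t′ = trans (sym (+-suc s k)) s+k≡t
  s<b = ≤-trans (subst (s <_) s+k≡t (m<m+n s (s≤s z≤n))) t≤b

inv-interior : ∀ {a P p} → parity P ≡ 0ℙ → Inv a P p → Interior p
inv-interior even (before {zero} _ odd) with trans (sym even) odd
... | ()
inv-interior even (before {suc u} _ _) = interior
inv-interior {P = P} even (after {zero} _ even′) with trans (sym (trans (parity-suc P) (cong _⁻¹ even))) even′
... | ()
inv-interior even (after {suc v} _ _) = interior

sum-map-+ : ∀ {A : Set} (g h : A → ℕ) xs → sum (map (λ x → g x + h x) xs) ≡ sum (map g xs) + sum (map h xs)
sum-map-+ g h []       = refl
sum-map-+ g h (x ∷ xs) = trans (cong (_+_ (g x + h x)) (sum-map-+ g h xs))
                               (interchange (g x) (h x) (sum (map g xs)) (sum (map h xs)))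

sum-map-0 : ∀ {A : Set} (xs : List A) → sum (map (λ _ → 0) xs) ≡ 0
sum-map-0 []       = refl
sum-map-0 (x ∷ xs) = sum-map-0 xs

sum-comm : ∀ {A B : Set} (f : A → B → ℕ) xs ys →
           sum (map (λ x → sum (map (f x) ys)) xs) ≡ sum (map (λ y → sum (map (λ x → f x y) xs)) ys)
sum-comm f []       ys = sym (sum-map-0 ys)
sum-comm f (x ∷ xs) ys = trans (cong (_+_ (sum (map (f x) ys))) (sum-comm f xs ys))
                               (sym (sum-map-+ (f x) (λ y → sum (map (λ x → f x y) xs)) ys))

sum-concatMap : ∀ {A B : Set} (f : B → ℕ) (g : A → List B) xs →
                sum (map f (concatMap g xs)) ≡ sum (map (λ x → sum (map f (g x))) xs)
sum-concatMap f g []       = refl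
sum-concatMap f g (x ∷ xs) = begin
  sum (map f (g x ++ concatMap g xs))                         ≡⟨ cong sum (map-++ f (g x) (concatMap g xs)) ⟩
  sum (map f (g x) ++ map f (concatMap g xs))                 ≡⟨ sum-++ (map f (g x)) _ ⟩
  sum (map f (g x)) + sum (map f (concatMap g xs))            ≡⟨ cong (_+_ (sum (map f (g x)))) (sum-concatMap f g xs) ⟩
  sum (map f (g x)) + sum (map (λ x → sum (map f (g x))) xs)  ∎
  where open ≡-Reasoning

-- The alphabet, in the order in which allWords prepends letters.
letters : List Letter
letters = one ∷ two ∷ one̅ ∷ two̅ ∷ []

sum-allWords-suc : ∀ m (f : Word → ℕ) →
                   sum (map f (allWords (suc m))) ≡ sum (map (λ w → sum (map (λ x → f (x ∷ w)) letters)) (allWords m))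
sum-allWords-suc m f = sum-concatMap f _ (allWords m)

sum-swapAt : ∀ m k (f : Word → ℕ) → sum (map (f ∘ swapAt k) (allWords m)) ≡ sum (map f (allWords m))
sum-swapAt zero          zero    f = refl
sum-swapAt zero          (suc k) f = refl
sum-swapAt (suc zero)    zero    f = refl
sum-swapAt (suc (suc m)) zero    f = begin
  sum (map (f ∘ swapAt 0) (allWords (suc (suc m))))
    ≡⟨ sum-allWords-suc (suc m) (f ∘ swapAt 0) ⟩
  sum (map (λ w → sum (map (λ x → f (swapAt 0 (x ∷ w))) letters)) (allWords (suc m)))
    ≡⟨ sum-allWords-suc m _ ⟩
  sum (map (λ w → sum (map (λ y → sum (map (λ x → f (y ∷ x ∷ w)) letters)) letters)) (allWords m))
    ≡⟨ cong sum (map-cong (λ w → sum-comm (λ y x → f (y ∷ x ∷ w)) letters letters) (allWords m)) ⟩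
  sum (map (λ w → sum (map (λ x → sum (map (λ y → f (y ∷ x ∷ w)) letters)) letters)) (allWords m))
    ≡⟨ sum-allWords-suc m _ ⟨
  sum (map (λ w → sum (map (λ y → f (y ∷ w)) letters)) (allWords (suc m)))
    ≡⟨ sum-allWords-suc (suc m) f ⟨
  sum (map f (allWords (suc (suc m)))) ∎
  where open ≡-Reasoning
sum-swapAt (suc m) (suc k) f = begin
  sum (map (f ∘ swapAt (suc k)) (allWords (suc m)))  ≡⟨ sum-allWords-suc m _ ⟩
  sum (map (extend ∘ swapAt k) (allWords m))         ≡⟨ sum-swapAt m k extend ⟩
  sum (map extend (allWords m))                      ≡⟨ sum-allWords-suc m f ⟨
  sum (map f (allWords (suc m)))                     ∎
  where
  open ≡-Reasoning
  extend : Word → ℕ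
  extend w = sum (map (λ x → f (x ∷ w)) letters)

allWords-length : ∀ m → All (λ w → length w ≡ m) (allWords m)
allWords-length zero    = refl ∷ []
allWords-length (suc m) =
  concat⁺ (map⁺ (All.map (λ len → let len′ = cong suc len in len′ ∷ len′ ∷ len′ ∷ len′ ∷ []) (allWords-length m)))

indicator : ∀ {A : Set} → Dec A → ℕ
indicator A? = if does A? then 1 else 0

length-filter : ∀ {P : Word → Set} (P? : ∀ w → Dec (P w)) ws → length (filter P? ws) ≡ sum (map (indicator ∘ P?) ws)
length-filter P? []       = refl
length-filter P? (w ∷ ws) with does (P? w)
... | true  = cong suc (length-filter P? ws)
... | false = length-filter P? ws

count-swapAt : ∀ k m {P Q : Word → Set} (P? : ∀ w → Dec (P w)) (Q? : ∀ w → Dec (Q w)) →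
               (∀ w → length w ≡ m → P (swapAt k w) ⇔ Q w) →
               length (filter P? (allWords m)) ≡ length (filter Q? (allWords m))
count-swapAt k m P? Q? P∘swap⇔Q = begin
  length (filter P? (allWords m))                      ≡⟨ length-filter P? (allWords m) ⟩
  sum (map (indicator ∘ P?) (allWords m))              ≡⟨ sum-swapAt m k (indicator ∘ P?) ⟨
  sum (map (indicator ∘ P? ∘ swapAt k) (allWords m))   ≡⟨ cong sum (map-cong-local (All.map same-indicator (allWords-length m))) ⟩
  sum (map (indicator ∘ Q?) (allWords m))              ≡⟨ length-filter Q? (allWords m) ⟨
  length (filter Q? (allWords m))                      ∎
  where
  open ≡-Reasoning
  same-indicator : ∀ {w} → length w ≡ m → indicator (P? (swapAt k w)) ≡ indicator (Q? w)
  same-indicator {w} len = cong (λ b → if b then 1 else 0) (does-⇔ (P∘swap⇔Q w len) (P? (swapAt k w)) (Q? w))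

×-⇔-dependent : ∀ {A A′ B B′ : Set} → B ⇔ B′ → (B′ → A ⇔ A′) → (A × B) ⇔ (A′ × B′)
×-⇔-dependent B⇔B′ A⇔A′ = mk⇔
  (λ (x , y) → let y′ = Equivalence.to B⇔B′ y in Equivalence.to (A⇔A′ y′) x , y′)
  (λ (x′ , y′) → Equivalence.from (A⇔A′ y′) x′ , Equivalence.from B⇔B′ y′)

G₁-transpose : ∀ {a b a′ b′} P m → 1 ≤ P → Transposed a b a′ b′ P → P < m → 1 ≤ a′ → P ≤ b′ → parity P ≡ 0ℙ →
               G₁ a b m ≡ G₁ a′ b′ m
G₁-transpose (suc k) m _ τ P<m 1≤a′ P≤b′ even = count-swapAt k m _ _ λ w len →
  let P<len = subst (suc k <_) (sym len) P<m in
  ×-⇔-dependent (shape-swapAt τ k 1 w refl P<len) λ shape′ →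
    completeGessel-swapAt k w (reach-swapAt k (0 , 0) w λ reached →
      inv-interior even (inv-reach k 1 w (≤-trans (n≤1+n k) (<⇒≤ P<len)) shape′ refl P≤b′ (before 1≤a′ refl) reached))

transposed-one̅ : ∀ {P b} → P + 1 < b → Transposed P b (P + 1) b P
transposed-one̅ {P} {b} P+1<b rewrite +-comm P 1 = record
  { outside = λ t t≢P t≢P+1 → both-false t≢P t≢P+1 , refl
  ; left    = trans (≡ᵇ-refl P) (sym (≡ᵇ-refl (suc P))) , both-false (<⇒≢ P<b) (<⇒≢ P+1<b)
  ; right   = both-false (>⇒≢ (n<1+n P)) (<⇒≢ (n<1+n P)) , both-false (<⇒≢ P+1<b) (<⇒≢ P<b)
  }
  where
  P<b = <-trans (n<1+n P) P+1<b

transposed-one : ∀ {a P} → a < P → Transposed a (P + 1) a P P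
transposed-one {a} {P} a<P rewrite +-comm P 1 = record
  { outside = λ t t≢P t≢P+1 → refl , both-false t≢P+1 t≢P
  ; left    = both-false (>⇒≢ a<P) (>⇒≢ a<P+1) , both-false (<⇒≢ (n<1+n P)) (>⇒≢ (n<1+n P))
  ; right   = both-false (>⇒≢ a<P+1) (>⇒≢ a<P) , trans (≡ᵇ-refl (suc P)) (sym (≡ᵇ-refl P))
  }
  where
  a<P+1 = <-trans a<P (n<1+n P)

parity-double : ∀ i → parity (2 * i) ≡ 0ℙ
parity-double i = *-homo-* 2 i

double-< : ∀ {i j} → i < j → 2 * i + 1 < 2 * j
double-< {i} {j} i<j = subst (_≤ 2 * j) (trans (*-suc 2 i) (cong suc (+-comm 1 (2 * i)))) (*-monoʳ-≤ 2 i<j)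

one-moves : ∀ a j n → 1 ≤ a → a < 2 * j → j < n → G₁ a (2 * j) (2 * n) ≡ G₁ a (2 * j + 1) (2 * n)
one-moves a j n 1≤a a<2j j<n = sym (G₁-transpose (2 * j) (2 * n) (≤-trans 1≤a (<⇒≤ a<2j)) (transposed-one a<2j)
  (<-trans (m<m+n (2 * j) (s≤s z≤n)) (double-< j<n)) 1≤a ≤-refl (parity-double j))

one̅-moves : ∀ i b n → 1 ≤ i → 2 * i + 1 < b → b ≤ 2 * n → G₁ (2 * i) b (2 * n) ≡ G₁ (2 * i + 1) b (2 * n)
one̅-moves i b n 1≤i 2i+1<b b≤2n = G₁-transpose (2 * i) (2 * n) (≤-trans (n≤1+n 1) (*-monoʳ-≤ 2 1≤i))
  (transposed-one̅ 2i+1<b) (≤-trans 2i<b b≤2n) (m≤n+m 1 (2 * i)) (<⇒≤ 2i<b) (parity-double i)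
  where
  2i<b : 2 * i < b
  2i<b = <-trans (m<m+n (2 * i) (s≤s z≤n)) 2i+1<b

-- The first and third equalities move the 1, the second moves the 1 back and then the 1̄.
lemma4p1 : (n i j : ℕ) → 1 ≤ n → 1 ≤ i → i < j → j ≤ n ∸ 1 →
    (G₁ (2 * i) (2 * j) (2 * n) ≡ G₁ (2 * i) (2 * j + 1) (2 * n))
    × (G₁ (2 * i) (2 * j + 1) (2 * n) ≡ G₁ (2 * i + 1) (2 * j) (2 * n))
    × (G₁ (2 * i + 1) (2 * j) (2 * n) ≡ G₁ (2 * i + 1) (2 * j + 1) (2 * n))
lemma4p1 (suc n) i j _ 1≤i i<j j≤n =
    one-moves (2 * i) j (suc n) 1≤2i 2i<2j j<n
  , trans (sym (one-moves (2 * i) j (suc n) 1≤2i 2i<2j j<n))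
          (one̅-moves i (2 * j) (suc n) 1≤i (double-< i<j) (*-monoʳ-≤ 2 (<⇒≤ j<n)))
  , one-moves (2 * i + 1) j (suc n) (m≤n+m 1 (2 * i)) (double-< i<j) j<n
  where
  j<n : j < suc n
  j<n = s≤s j≤n
  1≤2i : 1 ≤ 2 * i
  1≤2i = ≤-trans (n≤1+n 1) (*-monoʳ-≤ 2 1≤i)
  2i<2j : 2 * i < 2 * j
  2i<2j = <-trans (m<m+n (2 * i) (s≤s z≤n)) (double-< i<j)
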